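{- Let $\ell,c,d\in\mathbb{N}$, and let $\beta$ be a $(c,d)$-disjointed $\ell$-covering of a graph $G$. Then $\beta$ is $(c,f)$-disjointed, where $f(t):=dt^c$ for each $t\in\mathbb{N}$.
   Context: All graphs are finite and simple. For $S\subseteq V(G)$, $N_G(S)$ is the set of vertices adjacent to some vertex of $S$. An $\ell$-covering of $G$ is a set $\beta\subseteq 2^{V(G)}$ with $|B|\le\ell$ for all $B\in\beta$ and $\bigcup_{B\in\beta}B=V(G)$. A covering $\beta$ is $(c,d)$-disjointed if for every $(B_1,\dots,B_c)\in\beta^c$ and every component $X$ of $G-(B_1\cup\dots\cup B_c)$ there is $Q\subseteq V(X)$ with $|Q|\le d$ such that for each component $Y$ of $X-Q$ there is $i\in\{1,\dots,c\}$ with $V(Y)\cap N_G(B_i\setminus(B_1\cup\dots\cup B_{i-1}))=\emptyset$. For $t\in\mathbb{N}$, $\beta[t]:=\{\bigcup\mathcal{B} : \mathcal{B}\subseteq\beta, |\mathcal{B}|\le t\}$; for a function $f$, $\beta$ is $(c,f)$-disjointed if $\beta[t]$ is $(c,f(t))$-disjointed for every $t\in\mathbb{N}$. -}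

module Defs where

open import Level using (0ℓ)
open import Data.Nat using (ℕ; _≤_)
open import Data.Fin using (Fin) renaming (_<_ to _<ᶠ_)
open import Data.Fin.Subset using (Subset; _∈_; _∉_; ⋃; ∣_∣)
open import Data.Bool using (Bool; T; false)
open import Data.List using (List; length)
open import Data.List.Relation.Unary.All using (All)
import Data.List.Membership.Propositional as LM
open import Data.Product using (Σ; ∃; _×_)
open import Data.Empty using (⊥)
open import Relation.Binary.PropositionalEquality using (_≡_)
open import Relation.Unary using (Pred)
open import Function.Bundles using (_⇔_)

record Graph (n : ℕ) : Set where
  field
    E      : Fin n → Fin n → Bool
    sym    : ∀ u v → E u v ≡ E v u
    irrefl : ∀ u → E u u ≡ false

open Graph public

VSet : ℕ → Set₁
VSet n = Pred (Fin n) 0ℓ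

Adj : ∀ {n} → Graph n → Fin n → Fin n → Set
Adj G u v = T (E G u v)

Nbh : ∀ {n} → Graph n → VSet n → VSet n
Nbh G S v = ∃ λ u → S u × Adj G u v

data Reach {n} (G : Graph n) (S : VSet n) (u : Fin n) : Fin n → Set where
  here : S u → Reach G S u u
  step : ∀ {w v} → Reach G S u w → Adj G w v → S v → Reach G S u v

IsComponent : ∀ {n} → Graph n → VSet n → VSet n → Set
IsComponent G S X = Σ _ λ u → S u × (∀ v → X v ⇔ Reach G S u v)

IsCovering : ∀ {n} → Graph n → ℕ → List (Subset n) → Set
IsCovering {n} G ℓ β =
  (∀ B → B LM.∈ β → ∣ B ∣ ≤ ℓ) × (∀ (v : Fin n) → ∃ λ B → B LM.∈ β × v ∈ B)

Family : ℕ → Set₁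
Family n = Subset n → Set

NewPart : ∀ {n c} → (Fin c → Subset n) → Fin c → VSet n
NewPart Bs i v = v ∈ Bs i × (∀ j → j <ᶠ i → v ∉ Bs j)

Disjointed : ∀ {n} → Graph n → Family n → ℕ → ℕ → Set₁
Disjointed {n} G F c d =
  (Bs : Fin c → Subset n) → (∀ i → F (Bs i)) →
  (X : VSet n) → IsComponent G (λ v → ∀ i → v ∉ Bs i) X →
  Σ (Subset n) λ Q → (∀ v → v ∈ Q → X v) × ∣ Q ∣ ≤ d ×
    ((Y : VSet n) → IsComponent G (λ v → X v × v ∉ Q) Y →
       Σ (Fin c) λ i → ∀ v → Y v → Nbh G (NewPart Bs i) v → ⊥)

members : ∀ {n} → List (Subset n) → Family n
members β B = B LM.∈ β

_[_] : ∀ {n} → List (Subset n) → ℕ → Family n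
(β [ t ]) B = ∃ λ 𝓑 → length 𝓑 ≤ t × All (LM._∈ β) 𝓑 × B ≡ ⋃ 𝓑

DisjointedF : ∀ {n} → Graph n → List (Subset n) → ℕ → (ℕ → ℕ) → Set₁
DisjointedF G β c f = ∀ t → Disjointed G (β [ t ]) c (f t)

{-# OPTIONS --safe #-}
-- Write each B_i as the union of at most t members of β. For each of the at most t^c choices
-- σ of one such member σ_i ⊆ B_i per index, the component X of G - (B_1 ∪ … ∪ B_c) lies in a
-- component X_σ of G - (σ_1 ∪ … ∪ σ_c), for which (c,d)-disjointedness of β provides a set
-- Q_σ; take Q = X ∩ ⋃_σ Q_σ. If a component Y of X - Q met N(B_i ∖ (B_1 ∪ … ∪ B_{i-1})) for
-- every i, through vertices w_i ∈ B_i, then for the choice σ with w_i ∈ σ_i we would have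
-- w_i ∈ σ_i ∖ (σ_1 ∪ … ∪ σ_{i-1}) and Y inside one component of X_σ - Q_σ, contradicting the
-- choice of Q_σ. Extracting the index i constructively uses that reachability is decidable.
module Submission where

open import Defs hiding (sym)
open import Data.Nat using (ℕ; zero; suc; _+_; _*_; _^_; _≤_; _<_; s≤s; s≤s⁻¹)
open import Data.Nat.Properties
  using (≤-refl; ≤-trans; ≤-reflexive; <-≤-trans; n≤1+n; +-suc; +-monoʳ-≤; +-mono-≤; *-mono-≤;
         *-monoˡ-≤; *-comm)
open import Data.Fin using (Fin; zero; suc; _≟_)
open import Data.Fin.Properties using (any?; all?; ¬∀⟶∃¬; _<?_)
open import Data.Fin.Subset using (Subset; _∈_; _∉_; _⊆_; ∣_∣; ⋃; _∪_; _∩_; _-_; ⁅_⁆; ⊤)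
open import Data.Fin.Subset.Properties
  using (_∈?_; ∉⊥; ∈⊤; ∣⊥∣≡0; ∣p∣≤n; x∈p∪q⁺; x∈p∪q⁻; x∈p∩q⁺; x∈p∩q⁻; ∣p∩q∣≤∣p∣;
         p─q⊆p; x∈p∧x≢y⇒x∈p-y; x∈p⇒∣p-x∣<∣p∣)
open import Data.Vec using ([]; _∷_; tabulate)
open import Data.Vec.Properties using (lookup∘tabulate; []=⇒lookup; lookup⇒[]=)
import Data.Vec.Functional as Vector
open import Data.Bool using (true; false)
open import Data.List using (List; []; _∷_; [_]; map; length; cartesianProductWith)
open import Data.List.Properties using (length-++; length-map)
open import Data.List.Membership.Propositional using (mapWith∈; find; lose) renaming (_∈_ to _∈ˡ_)
open import Data.List.Membership.Propositional.Properties
  using (∈-cartesianProductWith⁺; ∈-cartesianProductWith⁻)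
open import Data.List.Relation.Unary.Any using (Any; here; there)
open import Data.List.Relation.Unary.Any.Properties using (mapWith∈⁺)
open import Data.List.Relation.Unary.All using (All)
import Data.List.Relation.Unary.All as All
open import Data.Product using (Σ; ∃; _×_; _,_; proj₁; proj₂; map₂)
open import Data.Sum using (_⊎_; inj₁; inj₂; [_,_]′)
open import Data.Empty using (⊥; ⊥-elim)
open import Function using (_∘_; id)
open import Function.Bundles using (Equivalence; mk⇔)
open import Relation.Nullary using (Dec; yes; no; does)
open import Relation.Nullary.Decidable using (map′; _×-dec_; _→-dec_; ¬?; T?; dec-true)
open import Relation.Unary using (Decidable) renaming (_⊆_ to _⊆ᵖ_)
open import Relation.Binary.PropositionalEquality using (_≡_; _≢_; refl; sym; trans; subst; cong₂)

open Equivalence using (to; from)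

private variable
  A B C : Set
  n c d d′ t : ℕ
  G : Graph n
  S S′ X : VSet n
  u v w : Fin n

reach-mono : S ⊆ᵖ S′ → Reach G S u v → Reach G S′ u v
reach-mono S⊆S′ (here su)     = here (S⊆S′ su)
reach-mono S⊆S′ (step r a sv) = step (reach-mono S⊆S′ r) a (S⊆S′ sv)

reach-source : Reach G S u v → S u
reach-source (here su)    = su
reach-source (step r _ _) = reach-source r

reach-cons : S u → Adj G u w → Reach G S w v → Reach G S u v
reach-cons su a (here sw)      = step (here su) a sw
reach-cons su a (step r a′ sv) = step (reach-cons su a r) a′ sv

reach-avoiding : Reach G S u v → u ≢ v → ∃ λ w → Adj G u w × Reach G (λ x → S x × x ≢ u) w v
reach-avoiding (here _) u≢u = ⊥-elim (u≢u refl)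
reach-avoiding {u = u} (step {w} {v} r a sv) u≢v with u ≟ w
... | yes refl = v , a , here (sv , u≢v ∘ sym)
... | no u≢w   = map₂ (map₂ λ r′ → step r′ a (sv , u≢v ∘ sym)) (reach-avoiding r u≢w)

-- By reach-avoiding the search from u may forbid u afterwards; the fuel k bounds ∣ p ∣.
reach?-within : ∀ k (p : Subset n) → ∣ p ∣ < k → Decidable S → ∀ u v →
                Dec (Reach G (λ x → S x × x ∈ p) u v)
reach?-within {G = G} (suc k) p ∣p∣<1+k S? u v with S? u ×-dec u ∈? p | u ≟ v
... | no ¬su             | _        = no (¬su ∘ reach-source)
... | yes su             | yes refl = yes (here su)
... | yes su@(_ , u∈p) | no u≢v   =
  map′ (λ (w , a , r) → reach-cons su a (reach-mono (map₂ (p─q⊆p p ⁅ u ⁆)) r))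
       (λ r → map₂ (map₂ (reach-mono λ ((sx , x∈p) , x≢u) → sx , x∈p∧x≢y⇒x∈p-y x∈p x≢u))
                   (reach-avoiding r u≢v))
       (any? λ w → T? (E G u w) ×-dec reach?-within k (p - u) ∣p-u∣<k S? w v)
  where
  ∣p-u∣<k : ∣ p - u ∣ < k
  ∣p-u∣<k = <-≤-trans (x∈p⇒∣p-x∣<∣p∣ u∈p) (s≤s⁻¹ ∣p∣<1+k)

reach? : ∀ {n} {G : Graph n} {S : VSet n} → Decidable S → ∀ u v → Dec (Reach G S u v)
reach? {n} {G} S? u v =
  map′ (reach-mono proj₁) (reach-mono (_, ∈⊤))
       (reach?-within {G = G} (suc n) ⊤ (s≤s (∣p∣≤n ⊤)) S? u v)

component? : IsComponent G S X → Decidable S → Decidable X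
component? (u , _ , X⇔) S? v = map′ (from (X⇔ v)) (to (X⇔ v)) (reach? S? u v)

nbh? : Decidable S → Decidable (Nbh G S)
nbh? {G = G} S? v = any? λ w → S? w ×-dec T? (E G w v)

fromDec : {P : VSet n} → Decidable P → Subset n
fromDec P? = tabulate (does ∘ P?)

∈-fromDec⁺ : {P : VSet n} (P? : Decidable P) → P v → v ∈ fromDec P?
∈-fromDec⁺ {v = v} P? pv =
  lookup⇒[]= v _ (trans (lookup∘tabulate (does ∘ P?) v) (dec-true (P? v) pv))

∈-fromDec⁻ : {P : VSet n} (P? : Decidable P) → v ∈ fromDec P? → P v
∈-fromDec⁻ {v = v} P? v∈ with P? v | trans (sym (lookup∘tabulate (does ∘ P?) v)) ([]=⇒lookup v∈)
... | yes pv | _ = pv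
... | no _   | ()

∣p∪q∣≤∣p∣+∣q∣ : (p q : Subset n) → ∣ p ∪ q ∣ ≤ ∣ p ∣ + ∣ q ∣
∣p∪q∣≤∣p∣+∣q∣ []          []          = ≤-refl
∣p∪q∣≤∣p∣+∣q∣ (true ∷ p)  (true ∷ q)  =
  s≤s (≤-trans (∣p∪q∣≤∣p∣+∣q∣ p q) (+-monoʳ-≤ ∣ p ∣ (n≤1+n ∣ q ∣)))
∣p∪q∣≤∣p∣+∣q∣ (true ∷ p)  (false ∷ q) = s≤s (∣p∪q∣≤∣p∣+∣q∣ p q)
∣p∪q∣≤∣p∣+∣q∣ (false ∷ p) (true ∷ q)  =
  subst (suc ∣ p ∪ q ∣ ≤_) (sym (+-suc ∣ p ∣ ∣ q ∣)) (s≤s (∣p∪q∣≤∣p∣+∣q∣ p q))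
∣p∪q∣≤∣p∣+∣q∣ (false ∷ p) (false ∷ q) = ∣p∪q∣≤∣p∣+∣q∣ p q

x∈⋃⁺ : {ps : List (Subset n)} → Any (v ∈_) ps → v ∈ ⋃ ps
x∈⋃⁺ (here v∈p)    = x∈p∪q⁺ (inj₁ v∈p)
x∈⋃⁺ (there v∈ps) = x∈p∪q⁺ (inj₂ (x∈⋃⁺ v∈ps))

x∈⋃⁻ : (ps : List (Subset n)) → v ∈ ⋃ ps → Any (v ∈_) ps
x∈⋃⁻ []       v∈⊥ = ⊥-elim (∉⊥ v∈⊥)
x∈⋃⁻ (p ∷ ps) v∈  = [ here , there ∘ x∈⋃⁻ ps ]′ (x∈p∪q⁻ p (⋃ ps) v∈)

∣⋃-mapWith∈∣≤ : (xs : List A) (f : ∀ {x} → x ∈ˡ xs → Subset n) →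
                (∀ {x} (x∈ : x ∈ˡ xs) → ∣ f x∈ ∣ ≤ d) → ∣ ⋃ (mapWith∈ xs f) ∣ ≤ length xs * d
∣⋃-mapWith∈∣≤ {n = n} []       f bound = ≤-reflexive (∣⊥∣≡0 n)
∣⋃-mapWith∈∣≤ (x ∷ xs) f bound =
  ≤-trans (∣p∪q∣≤∣p∣+∣q∣ (f (here refl)) (⋃ (mapWith∈ xs (f ∘ there))))
          (+-mono-≤ (bound (here refl)) (∣⋃-mapWith∈∣≤ xs (f ∘ there) (bound ∘ there)))

choices : ∀ c → (Fin c → List A) → List (Fin c → A)
choices zero    L = [ Vector.[] ]
choices (suc c) L = cartesianProductWith Vector._∷_ (L zero) (choices c (L ∘ suc))

∈-choices⁻ : (L : Fin c → List A) {σ : Fin c → A} → σ ∈ˡ choices c L → ∀ i → σ i ∈ˡ L i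
∈-choices⁻ {c = suc c} L σ∈ i
  with ∈-cartesianProductWith⁻ Vector._∷_ (L zero) (choices c (L ∘ suc)) σ∈
∈-choices⁻ {c = suc c} L σ∈ zero    | a , τ , a∈ , τ∈ , refl = a∈
∈-choices⁻ {c = suc c} L σ∈ (suc i) | a , τ , a∈ , τ∈ , refl = ∈-choices⁻ (L ∘ suc) τ∈ i

choices-complete : {P : Fin c → A → Set} (L : Fin c → List A) →
                   (∀ i → Any (P i) (L i)) → Any (λ σ → ∀ i → P i (σ i)) (choices c L)
choices-complete {c = zero}  L _    = here λ ()
choices-complete {c = suc c} {P = P} L anys
  with a , a∈ , pa ← find (anys zero)
     | τ , τ∈ , pτ ← find (choices-complete {P = P ∘ suc} (L ∘ suc) (anys ∘ suc))
  = lose (∈-cartesianProductWith⁺ Vector._∷_ a∈ τ∈) λ { zero → pa ; (suc i) → pτ i }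

length-cartesianProductWith : (f : A → B → C) (xs : List A) (ys : List B) →
                              length (cartesianProductWith f xs ys) ≡ length xs * length ys
length-cartesianProductWith f []       ys = refl
length-cartesianProductWith f (x ∷ xs) ys = trans (length-++ (map (f x) ys))
  (cong₂ _+_ (length-map (f x) ys) (length-cartesianProductWith f xs ys))

length-choices≤ : (L : Fin c → List A) → (∀ i → length (L i) ≤ t) → length (choices c L) ≤ t ^ c
length-choices≤ {c = zero}  L _ = ≤-refl
length-choices≤ {c = suc c} L bound =
  subst (_≤ _) (sym (length-cartesianProductWith Vector._∷_ (L zero) (choices c (L ∘ suc))))
        (*-mono-≤ (bound zero) (length-choices≤ (L ∘ suc) (bound ∘ suc)))

Outside : ∀ {n c} → (Fin c → Subset n) → VSet n
Outside Bs v = ∀ i → v ∉ Bs i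

Touches : ∀ {n} → Graph n → VSet n → VSet n → Set
Touches G Y S = ∃ λ v → Y v × Nbh G S v

-- Disjointed G F c d unfolds to ∀ Bs → (∀ i → F (Bs i)) → DisjointedTuple G Bs d.
DisjointedTuple : ∀ {n c} → Graph n → (Fin c → Subset n) → ℕ → Set₁
DisjointedTuple {n} {c} G Bs d =
  (X : VSet n) → IsComponent G (Outside Bs) X →
  Σ (Subset n) λ Q → (∀ v → v ∈ Q → X v) × ∣ Q ∣ ≤ d ×
    ((Y : VSet n) → IsComponent G (λ v → X v × v ∉ Q) Y →
       Σ (Fin c) λ i → ∀ v → Y v → Nbh G (NewPart Bs i) v → ⊥)

outside? : (Bs : Fin c → Subset n) → Decidable (Outside Bs)
outside? Bs v = all? λ i → ¬? (v ∈? Bs i)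

newPart? : (Bs : Fin c → Subset n) → ∀ i → Decidable (NewPart Bs i)
newPart? Bs i v = v ∈? Bs i ×-dec all? λ j → j <? i →-dec ¬? (v ∈? Bs j)

outside-antitone : {σ Bs : Fin c → Subset n} → (∀ i → σ i ⊆ Bs i) → Outside Bs ⊆ᵖ Outside σ
outside-antitone σ⊆Bs v∉Bs i v∈σi = v∉Bs i (σ⊆Bs i v∈σi)

newPart-refine : {σ Bs : Fin c → Subset n} {i : Fin c} →
                 (∀ j → σ j ⊆ Bs j) → v ∈ σ i → NewPart Bs i v → NewPart σ i v
newPart-refine σ⊆Bs v∈σi (_ , new) = v∈σi , λ j j<i v∈σj → new j j<i (σ⊆Bs j v∈σj)

disjointedTuple-mono : {Bs : Fin c → Subset n} →
                       d ≤ d′ → DisjointedTuple G Bs d → DisjointedTuple G Bs d′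
disjointedTuple-mono d≤d′ sep X X-comp with sep X X-comp
... | Q , Q⊆X , ∣Q∣≤d , separates = Q , Q⊆X , ≤-trans ∣Q∣≤d d≤d′ , separates

touches? : {Y S : VSet n} → Decidable Y → Decidable S → Dec (Touches G Y S)
touches? {G = G} Y? S? = any? λ v → Y? v ×-dec nbh? {G = G} S? v

avoids-some-or-touches-all : {Y : VSet n} → Decidable Y → (Bs : Fin c → Subset n) →
  (Σ (Fin c) λ i → ∀ v → Y v → Nbh G (NewPart Bs i) v → ⊥) ⊎ (∀ i → Touches G Y (NewPart Bs i))
avoids-some-or-touches-all {c = c} {G = G} Y? Bs with all? (touches? {G = G} Y? ∘ newPart? Bs)
... | yes touchesAll = inj₂ touchesAll
... | no ¬touchesAll =
  inj₁ (map₂ (λ ¬touches v Yv nb → ¬touches (v , Yv , nb))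
             (¬∀⟶∃¬ c _ (touches? {G = G} Y? ∘ newPart? Bs) ¬touchesAll))

disjointedTuple-cover : {Bs : Fin c → Subset n} (Σs : List (Fin c → Subset n)) →
  (∀ {σ} → σ ∈ˡ Σs → DisjointedTuple G σ d) →
  (∀ {σ} → σ ∈ˡ Σs → ∀ i → σ i ⊆ Bs i) →
  (∀ (w : Fin c → Fin n) → (∀ i → w i ∈ Bs i) → Any (λ σ → ∀ i → w i ∈ σ i) Σs) →
  DisjointedTuple G Bs (length Σs * d)
disjointedTuple-cover {c = c} {n = n} {G = G} {d = d} {Bs = Bs} Σs sep σ⊆Bs covered
                      X X-comp@(u , u∉Bs , X⇔) =
  Q , Q⊆X , ∣Q∣≤ , separates
  where
  X? : Decidable X
  X? = component? X-comp (outside? Bs)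

  Xσ : (Fin c → Subset n) → VSet n
  Xσ σ = Reach G (Outside σ) u

  X⊆Xσ : ∀ {σ} → σ ∈ˡ Σs → X ⊆ᵖ Xσ σ
  X⊆Xσ σ∈ {v} Xv = reach-mono (outside-antitone (σ⊆Bs σ∈)) (to (X⇔ v) Xv)

  Xσ-comp : ∀ {σ} → σ ∈ˡ Σs → IsComponent G (Outside σ) (Xσ σ)
  Xσ-comp σ∈ = u , outside-antitone (σ⊆Bs σ∈) u∉Bs , λ _ → mk⇔ id id

  Qσ : ∀ {σ} → σ ∈ˡ Σs → Subset n
  Qσ σ∈ = proj₁ (sep σ∈ _ (Xσ-comp σ∈))

  Q : Subset n
  Q = ⋃ (mapWith∈ Σs Qσ) ∩ fromDec X?

  Q⊆X : ∀ v → v ∈ Q → X v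
  Q⊆X v v∈Q = ∈-fromDec⁻ X? (proj₂ (x∈p∩q⁻ _ _ v∈Q))

  ∣Q∣≤ : ∣ Q ∣ ≤ length Σs * d
  ∣Q∣≤ = ≤-trans (∣p∩q∣≤∣p∣ (⋃ (mapWith∈ Σs Qσ)) (fromDec X?))
                 (∣⋃-mapWith∈∣≤ {d = d} Σs Qσ λ σ∈ → proj₁ (proj₂ (proj₂ (sep σ∈ _ (Xσ-comp σ∈)))))

  separates : (Y : VSet n) → IsComponent G (λ v → X v × v ∉ Q) Y →
              Σ (Fin c) λ i → ∀ v → Y v → Nbh G (NewPart Bs i) v → ⊥
  separates Y Y-comp@(y , Xy∉Q , Y⇔) =
    [ id , ⊥-elim ∘ touchesAll-impossible ]′ (avoids-some-or-touches-all {G = G} Y? Bs)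
    where
    Y? : Decidable Y
    Y? = component? Y-comp λ v → X? v ×-dec ¬? (v ∈? Q)

    Yσ : ∀ {σ} → σ ∈ˡ Σs → VSet n
    Yσ {σ} σ∈ = Reach G (λ v → Xσ σ v × v ∉ Qσ σ∈) y

    Q-avoided : ∀ {σ v} (σ∈ : σ ∈ˡ Σs) → X v × v ∉ Q → Xσ σ v × v ∉ Qσ σ∈
    Q-avoided σ∈ (Xv , v∉Q) =
      X⊆Xσ σ∈ Xv ,
      λ v∈Qσ → v∉Q (x∈p∩q⁺ (x∈⋃⁺ (mapWith∈⁺ Qσ (_ , σ∈ , v∈Qσ)) , ∈-fromDec⁺ X? Xv))

    Y⊆Yσ : ∀ {σ} (σ∈ : σ ∈ˡ Σs) → Y ⊆ᵖ Yσ σ∈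
    Y⊆Yσ σ∈ {v} Yv = reach-mono (Q-avoided σ∈) (to (Y⇔ v) Yv)

    Yσ-comp : ∀ {σ} (σ∈ : σ ∈ˡ Σs) → IsComponent G (λ v → Xσ σ v × v ∉ Qσ σ∈) (Yσ σ∈)
    Yσ-comp σ∈ = y , Q-avoided σ∈ Xy∉Q , λ _ → mk⇔ id id

    touchesAll-impossible : (∀ i → Touches G Y (NewPart Bs i)) → ⊥
    touchesAll-impossible touches =
      let σ , σ∈ , w∈σ = find (covered neighbour (proj₁ ∘ neighbour-new))
          i , avoids   = proj₂ (proj₂ (proj₂ (sep σ∈ _ (Xσ-comp σ∈)))) _ (Yσ-comp σ∈)
          v , Yv , _ , _ , adj = touches i
      in avoids v (Y⊆Yσ σ∈ Yv)
                (neighbour i , newPart-refine (σ⊆Bs σ∈) (w∈σ i) (neighbour-new i) , adj)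
      where
      neighbour : Fin c → Fin n
      neighbour i = proj₁ (proj₂ (proj₂ (touches i)))

      neighbour-new : ∀ i → NewPart Bs i (neighbour i)
      neighbour-new i = proj₁ (proj₂ (proj₂ (proj₂ (touches i))))

disjointed-unions : {F : Family n} {Bs : Fin c → Subset n} → Disjointed G F c d →
  (𝓑 : Fin c → List (Subset n)) → (∀ i → All F (𝓑 i)) → (∀ i → length (𝓑 i) ≤ t) →
  (∀ i → Bs i ≡ ⋃ (𝓑 i)) → DisjointedTuple G Bs (d * t ^ c)
disjointed-unions {c = c} {d = d} {t = t} {Bs = Bs} disjointed 𝓑 𝓑⊆F ∣𝓑∣≤t Bs≡⋃𝓑 =
  disjointedTuple-mono ∣choices∣*d≤d*t^c (disjointedTuple-cover (choices c 𝓑)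
    (λ σ∈ → disjointed _ λ i → All.lookup (𝓑⊆F i) (∈-choices⁻ 𝓑 σ∈ i))
    (λ σ∈ i v∈σi → ∈Bs⁺ i (lose (∈-choices⁻ 𝓑 σ∈ i) v∈σi))
    (λ w w∈Bs → choices-complete 𝓑 λ i → ∈Bs⁻ i (w∈Bs i)))
  where
  ∈Bs⁺ : ∀ i → Any (v ∈_) (𝓑 i) → v ∈ Bs i
  ∈Bs⁺ i = subst (_ ∈_) (sym (Bs≡⋃𝓑 i)) ∘ x∈⋃⁺

  ∈Bs⁻ : ∀ i → v ∈ Bs i → Any (v ∈_) (𝓑 i)
  ∈Bs⁻ i = x∈⋃⁻ (𝓑 i) ∘ subst (_ ∈_) (Bs≡⋃𝓑 i)

  ∣choices∣*d≤d*t^c : length (choices c 𝓑) * d ≤ d * t ^ c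
  ∣choices∣*d≤d*t^c =
    ≤-trans (*-monoˡ-≤ d (length-choices≤ 𝓑 ∣𝓑∣≤t)) (≤-reflexive (*-comm (t ^ c) d))

mainTheorem15 : ∀ {n} (G : Graph n) (ℓ c d : ℕ) (β : List (Subset n)) →
    IsCovering G ℓ β → Disjointed G (members β) c d →
    DisjointedF G β c (λ t → d * t ^ c)
mainTheorem15 G ℓ c d β _ disjointed t Bs Bs∈β[t] =
  disjointed-unions disjointed 𝓑 𝓑⊆β ∣𝓑∣≤t Bs≡⋃𝓑
  where
  𝓑 : Fin c → List (Subset _)
  𝓑 i = proj₁ (Bs∈β[t] i)

  ∣𝓑∣≤t : ∀ i → length (𝓑 i) ≤ t
  ∣𝓑∣≤t i = proj₁ (proj₂ (Bs∈β[t] i))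

  𝓑⊆β : ∀ i → All (_∈ˡ β) (𝓑 i)
  𝓑⊆β i = proj₁ (proj₂ (proj₂ (Bs∈β[t] i)))

  Bs≡⋃𝓑 : ∀ i → Bs i ≡ ⋃ (𝓑 i)
  Bs≡⋃𝓑 i = proj₂ (proj₂ (proj₂ (Bs∈β[t] i)))
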